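{- Let $G$ be a graph and let $D$ be an orientation of $G$ (a corresponding digraph). Suppose that $\mathcal{C}_1$ and $\mathcal{C}_2$ are sets of arc-disjoint directed cycles in $D$ and in $D^{ -1}$, respectively, such that $\mathcal{C}_1\cup\mathcal{C}_2$ is blossom-free in $D\cup D^{ -1}$. Then there exists a rotation system $\Pi$ of $G$ such that every cycle in $\mathcal{C}_1\cup\mathcal{C}_2$ is a face (facial walk) of $\Pi$.
   Context: A corresponding digraph $D$ of a simple graph $G$ has $V(D)=V(G)$ and contains, for each edge $uv$ of $G$, exactly one of the arcs $\overrightarrow{uv},\overrightarrow{vu}$. $D^{ -1}$ is obtained from $D$ by reversing every arc. A rotation system of $G$ is a family $\{\pi_v\}_{v\in V(G)}$ where $\pi_v$ is a cyclic permutation of the edges incident with $v$; it determines a 2-cell embedding in an orientable surface, whose face boundaries are the $\Pi$-facial walks. A blossom of length $l$ with center $v$ and tips $v_1,\dots,v_l$ is a set of $l$ directed cycles $C_1,\dots,C_l$ such that $\overrightarrow{v_iv},\overrightarrow{vv_{i+1}}\in C_i$ for $i=1,\dots,l$, where $v_{l+1}=v_1$. A family $\mathcal{C}$ of arc-disjoint closed trails in $D\cup D^{ -1}$ is blossom-free if no subset of $\mathcal{C}$ forms a blossom centered at some vertex. -}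

module Defs where

open import Data.Nat using (ℕ; zero; suc; _≤_)
open import Data.Nat.DivMod using (_%_; m%n<n)
open import Data.Fin using (Fin; toℕ; fromℕ<)
open import Data.Bool using (Bool; true; false)
open import Data.List using (List; []; _∷_; _++_; take; length; lookup; concatMap)
open import Data.List.Relation.Unary.All using (All)
open import Data.List.Relation.Unary.Unique.Propositional using (Unique)
open import Data.List.Membership.Propositional using (_∈_)
open import Data.Product using (_×_; _,_; ∃; ∃-syntax)
open import Data.Sum using (_⊎_)
open import Relation.Binary.PropositionalEquality using (_≡_; _≢_)
open import Relation.Nullary using (¬_)
open import Function.Definitions using (Injective)

Adj : ∀ {n} → (Fin n → Fin n → Bool) → Fin n → Fin n → Set
Adj G u v = G u v ≡ true

SimpleGraph : ∀ {n} → (Fin n → Fin n → Bool) → Set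
SimpleGraph {n} G = (∀ u v → Adj G u v → Adj G v u) × (∀ v → ¬ Adj G v v)

IsOrientation : ∀ {n} → (G D : Fin n → Fin n → Bool) → Set
IsOrientation {n} G D =
  (∀ u v → Adj D u v → Adj G u v) ×
  (∀ u v → Adj G u v → (Adj D u v ⊎ Adj D v u) × ¬ (Adj D u v × Adj D v u))

inv : ∀ {n} → (Fin n → Fin n → Bool) → Fin n → Fin n → Bool
inv D u v = D v u

pairs : ∀ {A : Set} → List A → List (A × A)
pairs (x ∷ y ∷ r) = (x , y) ∷ pairs (y ∷ r)
pairs _ = []

triples : ∀ {A : Set} → List A → List (A × A × A)
triples (x ∷ y ∷ z ∷ r) = (x , y , z) ∷ triples (y ∷ z ∷ r)
triples _ = []

-- A closed walk is given by its cyclic vertex sequence v₀ … v_{k-1};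
-- its arcs are (v₀,v₁), …, (v_{k-1},v₀).
arcsOf : ∀ {A : Set} → List A → List (A × A)
arcsOf c = pairs (c ++ take 1 c)

DirCycle : ∀ {n} → (Fin n → Fin n → Bool) → List (Fin n) → Set
DirCycle R c = (1 ≤ length c) × Unique c × All (λ a → Adj R (Data.Product.proj₁ a) (Data.Product.proj₂ a)) (arcsOf c)

ArcDisjoint : ∀ {n} → List (List (Fin n)) → Set
ArcDisjoint F = Unique (concatMap arcsOf F)

csuc : ∀ {m} → Fin (suc m) → Fin (suc m)
csuc {m} i = fromℕ< (m%n<n (suc (toℕ i)) (suc m))

-- A blossom of length l = suc m with center v and tips tips 0 … tips m,
-- formed by l distinct members (indices idx) of the family F:
-- the i-th cycle contains the arcs (tips i, v) and (v, tips (i+1 mod l)).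
Blossom : ∀ {n} (F : List (List (Fin n))) (v : Fin n) (m : ℕ)
          (idx : Fin (suc m) → Fin (length F)) (tips : Fin (suc m) → Fin n) → Set
Blossom F v m idx tips =
  Injective _≡_ _≡_ idx ×
  (∀ i → ((tips i , v) ∈ arcsOf (lookup F (idx i))) ×
         ((v , tips (csuc i)) ∈ arcsOf (lookup F (idx i))))

BlossomFree : ∀ {n} → List (List (Fin n)) → Set
BlossomFree {n} F = ∀ (v : Fin n) (m : ℕ) idx tips → ¬ Blossom F v m idx tips

iter : ∀ {A : Set} → (A → A) → ℕ → A → A
iter f zero x = x
iter f (suc k) x = f (iter f k x)

-- Rotation system: for each vertex v, ρ v restricted to the neighbours of v
-- (= edges incident with v, G being simple) is a cyclic permutation:
-- it maps neighbours to neighbours, is injective on them, and has one orbit.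
IsRotationSystem : ∀ {n} → (Fin n → Fin n → Bool) → (Fin n → Fin n → Fin n) → Set
IsRotationSystem G ρ = ∀ v →
  (∀ u → Adj G v u → Adj G v (ρ v u)) ×
  (∀ u w → Adj G v u → Adj G v w → ρ v u ≡ ρ v w → u ≡ w) ×
  (∀ u w → Adj G v u → Adj G v w → ∃[ k ] iter (ρ v) k u ≡ w)

-- Face tracing: the arc (x,y) is followed by the arc (y, ρ y x).
-- A closed walk v₀ … v_{k-1} is a Π-facial walk iff every cyclically
-- consecutive triple (x,y,z) satisfies ρ y x ≡ z.
Facial : ∀ {n} → (Fin n → Fin n → Fin n) → List (Fin n) → Set
Facial ρ c = All (λ t → ρ (Data.Product.proj₁ (Data.Product.proj₂ t)) (Data.Product.proj₁ t) ≡ Data.Product.proj₂ (Data.Product.proj₂ t)) (triples (c ++ take 2 c))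

module Submission where

-- At a vertex v, every corner (x , v , z) of a walk of the family is a transition x ↦ z between
-- neighbours of v. Arc-disjointness makes the transitions at v a partial injection, since each arc
-- into or out of v lies on at most one walk, and blossom-freeness says that they contain no cycle.
-- So they form disjoint paths, which can be concatenated into a single cyclic order of all
-- neighbours of v in which every transition is a step; taking π_v to be that cyclic successor,
-- face tracing follows each walk of the family, so each walk is a facial walk. For C₁ ∪ C₂ the
-- family is arc-disjoint because D and D⁻¹ have no arc in common.

open import Defs
open import Data.Nat using (ℕ)
open import Data.Fin using (Fin)
open import Data.Bool using (Bool)
open import Data.List using (List; _++_)
open import Data.List.Relation.Unary.All using (All)
open import Data.Product using (_×_; ∃-syntax)

open import Data.Nat using (zero; suc; _+_) renaming (_≟_ to _≟ℕ_)
open import Data.Nat.Properties using (suc-injective; ≤∧≢⇒<)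
open import Data.Nat.DivMod using (_%_; m<n⇒m%n≡m; n%n≡0)
import Data.Fin as Fin
open import Data.Fin.Properties using (toℕ-fromℕ<; toℕ-injective; toℕ<n)
open import Data.Bool using (true)
import Data.Bool as Bool
open import Data.List using ([]; _∷_; _∷ʳ_; [_]; take; length; lookup; concat; concatMap; map; filter; allFin)
open import Data.List.Properties using (++-assoc; concat-map-[_]; concatMap-++)
open import Data.List.Relation.Unary.Any using (Any; here; there; index)
open import Data.List.Relation.Unary.Any.Properties using (lookup-index)
import Data.List.Relation.Unary.All as All
import Data.List.Relation.Unary.All.Properties as All
open import Data.List.Relation.Unary.AllPairs using ([]; _∷_)
open import Data.List.Relation.Unary.Unique.Propositional using (Unique)
import Data.List.Relation.Unary.Unique.Propositional.Properties as Unique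
open import Data.List.Relation.Binary.Subset.Propositional using (_⊆_)
open import Data.List.Relation.Binary.Disjoint.Propositional using (Disjoint)
open import Data.List.Membership.Propositional using (_∈_; lose)
open import Data.List.Membership.Propositional.Properties
  using (∈-++⁺ʳ; ∈-++⁻; ∈-concat⁻′; ∈-∃++; ∈-map⁺; ∈-map⁻; ∈-filter⁺; ∈-filter⁻;
         ∈-concatMap⁺; ∈-concatMap⁻; ∈-lookup; ∈-allFin)
open import Data.List.Relation.Binary.Permutation.Propositional
  using (_↭_; refl; prep; swap; trans; ↭-refl; ↭-sym; ↭-trans; ↭-reflexive; ↭⇒↭ₛ)
open import Data.List.Relation.Binary.Permutation.Propositional.Properties
  using (Any-resp-↭; ∈-resp-↭; ++⁺ˡ; shift; shifts; ∷↭∷ʳ)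
import Data.List.Relation.Binary.Permutation.Setoid.Properties as Permutationₛ
open import Data.Product using (_,_; proj₁; proj₂; ∃)
open import Data.Sum using (_⊎_; inj₁; inj₂)
open import Data.Empty using (⊥-elim)
open import Function using (_∘_)
open import Relation.Nullary using (¬_; yes; no)
open import Relation.Binary.Definitions using (DecidableEquality)
open import Relation.Binary.PropositionalEquality
  using (_≡_; refl; sym; cong; subst; setoid; module ≡-Reasoning)

module _ {A : Set} where

  Unique-resp-↭ : ∀ {xs ys : List A} → xs ↭ ys → Unique xs → Unique ys
  Unique-resp-↭ xs↭ys = Permutationₛ.Unique-resp-↭ (setoid A) (↭⇒↭ₛ xs↭ys)

  concat-resp-↭ : ∀ {xss yss : List (List A)} → xss ↭ yss → concat xss ↭ concat yss
  concat-resp-↭ refl = ↭-refl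
  concat-resp-↭ (prep xs p) = ++⁺ˡ xs (concat-resp-↭ p)
  concat-resp-↭ (swap xs ys p) = ↭-trans (shifts xs ys) (++⁺ˡ ys (++⁺ˡ xs (concat-resp-↭ p)))
  concat-resp-↭ (trans p q) = ↭-trans (concat-resp-↭ p) (concat-resp-↭ q)

  ∈⇒↭-∷ : ∀ {x : A} {xs} → x ∈ xs → ∃ λ ys → xs ↭ x ∷ ys
  ∈⇒↭-∷ x∈ with ∈-∃++ x∈
  ... | ys , zs , refl = ys ++ zs , shift _ ys zs

  Unique-++⁻ˡ : ∀ (xs : List A) {ys} → Unique (xs ++ ys) → Unique xs
  Unique-++⁻ˡ [] _ = []
  Unique-++⁻ˡ (x ∷ xs) (x∉ ∷ xs!) = All.++⁻ˡ xs x∉ ∷ Unique-++⁻ˡ xs xs!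

  Unique-++⁻ʳ : ∀ (xs : List A) {ys} → Unique (xs ++ ys) → Unique ys
  Unique-++⁻ʳ [] ys! = ys!
  Unique-++⁻ʳ (x ∷ xs) (_ ∷ xs!) = Unique-++⁻ʳ xs xs!

  Unique-++⇒Disjoint : ∀ (xs : List A) {ys} → Unique (xs ++ ys) → Disjoint xs ys
  Unique-++⇒Disjoint (x ∷ xs) (x∉ ∷ _) (here refl , v∈ys) = All.lookup x∉ (∈-++⁺ʳ xs v∈ys) refl
  Unique-++⇒Disjoint (x ∷ xs) (_ ∷ xs!) (there v∈xs , v∈ys) = Unique-++⇒Disjoint xs xs! (v∈xs , v∈ys)

  Unique⇒lookup-injective : ∀ (xs : List A) → Unique xs → ∀ {i j} → lookup xs i ≡ lookup xs j → i ≡ j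
  Unique⇒lookup-injective (x ∷ xs) _ {Fin.zero} {Fin.zero} _ = refl
  Unique⇒lookup-injective (x ∷ xs) (x∉ ∷ _) {Fin.zero} {Fin.suc j} eq = ⊥-elim (All.lookup x∉ (∈-lookup j) eq)
  Unique⇒lookup-injective (x ∷ xs) (x∉ ∷ _) {Fin.suc i} {Fin.zero} eq =
    ⊥-elim (All.lookup x∉ (∈-lookup i) (sym eq))
  Unique⇒lookup-injective (x ∷ xs) (_ ∷ xs!) {Fin.suc i} {Fin.suc j} eq =
    cong Fin.suc (Unique⇒lookup-injective xs xs! eq)

  Unique-concatMap⇒same-index : ∀ {B : Set} (f : B → List A) (xs : List B) → Unique (concatMap f xs) →
    ∀ {e i j} → e ∈ f (lookup xs i) → e ∈ f (lookup xs j) → i ≡ j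
  Unique-concatMap⇒same-index f (x ∷ xs) xs! {i = Fin.zero} {Fin.zero} _ _ = refl
  Unique-concatMap⇒same-index f (x ∷ xs) xs! {i = Fin.zero} {Fin.suc j} e∈ e∈′ =
    ⊥-elim (Unique-++⇒Disjoint (f x) xs! (e∈ , ∈-concatMap⁺ f (lose (∈-lookup {xs = xs} j) e∈′)))
  Unique-concatMap⇒same-index f (x ∷ xs) xs! {i = Fin.suc i} {Fin.zero} e∈ e∈′ =
    ⊥-elim (Unique-++⇒Disjoint (f x) xs! (e∈′ , ∈-concatMap⁺ f (lose (∈-lookup {xs = xs} i) e∈)))
  Unique-concatMap⇒same-index f (x ∷ xs) xs! {i = Fin.suc i} {Fin.suc j} e∈ e∈′ =
    cong Fin.suc (Unique-concatMap⇒same-index f xs (Unique-++⁻ʳ (f x) xs!) e∈ e∈′)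

module _ {A : Set} where

  ∈-pairs-∷ : ∀ {p : A × A} {a} xs → p ∈ pairs xs → p ∈ pairs (a ∷ xs)
  ∈-pairs-∷ (_ ∷ _) p∈ = there p∈

  ∈-pairs-++⁺ˡ : ∀ {p : A × A} xs {ys} → p ∈ pairs xs → p ∈ pairs (xs ++ ys)
  ∈-pairs-++⁺ˡ (x ∷ y ∷ xs) (here refl) = here refl
  ∈-pairs-++⁺ˡ (x ∷ y ∷ xs) (there p∈) = there (∈-pairs-++⁺ˡ (y ∷ xs) p∈)

  ∈-pairs-++⁺ʳ : ∀ {p : A × A} xs {ys} → p ∈ pairs ys → p ∈ pairs (xs ++ ys)
  ∈-pairs-++⁺ʳ [] p∈ = p∈
  ∈-pairs-++⁺ʳ (x ∷ xs) p∈ = ∈-pairs-∷ (xs ++ _) (∈-pairs-++⁺ʳ xs p∈)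

  ∈-pairs-++⁻ : ∀ {p : A × A} xs a ys → p ∈ pairs (xs ++ a ∷ ys) →
                p ∈ pairs (xs ∷ʳ a) ⊎ p ∈ pairs (a ∷ ys)
  ∈-pairs-++⁻ [] a ys p∈ = inj₂ p∈
  ∈-pairs-++⁻ (x ∷ []) a ys (here refl) = inj₁ (here refl)
  ∈-pairs-++⁻ (x ∷ []) a ys (there p∈) = inj₂ p∈
  ∈-pairs-++⁻ (x ∷ y ∷ xs) a ys (here refl) = inj₁ (here refl)
  ∈-pairs-++⁻ (x ∷ y ∷ xs) a ys (there p∈) with ∈-pairs-++⁻ (y ∷ xs) a ys p∈
  ... | inj₁ p∈ˡ = inj₁ (there p∈ˡ)
  ... | inj₂ p∈ʳ = inj₂ p∈ʳ

  ∈-pairs-concat⁺ : ∀ {p : A × A} xss → Any (λ xs → p ∈ pairs xs) xss → p ∈ pairs (concat xss)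
  ∈-pairs-concat⁺ (xs ∷ xss) (here p∈) = ∈-pairs-++⁺ˡ xs p∈
  ∈-pairs-concat⁺ (xs ∷ xss) (there p∈) = ∈-pairs-++⁺ʳ xs (∈-pairs-concat⁺ xss p∈)

  ∈-pairs-∷ʳ⁻ˡ : ∀ {x y e : A} xs → (x , y) ∈ pairs (xs ∷ʳ e) → x ∈ xs
  ∈-pairs-∷ʳ⁻ˡ (a ∷ []) (here refl) = here refl
  ∈-pairs-∷ʳ⁻ˡ (a ∷ b ∷ xs) (here refl) = here refl
  ∈-pairs-∷ʳ⁻ˡ (a ∷ b ∷ xs) (there p∈) = there (∈-pairs-∷ʳ⁻ˡ (b ∷ xs) p∈)

  ∈-pairs-∷⁻ʳ : ∀ {x y a : A} xs → (x , y) ∈ pairs (a ∷ xs) → y ∈ xs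
  ∈-pairs-∷⁻ʳ (b ∷ xs) (here refl) = here refl
  ∈-pairs-∷⁻ʳ (b ∷ xs) (there p∈) = there (∈-pairs-∷⁻ʳ xs p∈)

  ∈⇒∈-pairs-∷ʳ : ∀ {x : A} xs e → x ∈ xs → ∃ λ y → (x , y) ∈ pairs (xs ∷ʳ e)
  ∈⇒∈-pairs-∷ʳ (a ∷ []) e (here refl) = e , here refl
  ∈⇒∈-pairs-∷ʳ (a ∷ b ∷ xs) e (here refl) = b , here refl
  ∈⇒∈-pairs-∷ʳ (a ∷ b ∷ xs) e (there x∈) =
    let y , p∈ = ∈⇒∈-pairs-∷ʳ (b ∷ xs) e x∈ in y , there p∈

  ∈⇒successor⊎last : ∀ {x : A} xs → x ∈ xs →
                     (∃ λ y → (x , y) ∈ pairs xs) ⊎ (∃ λ ys → xs ≡ ys ∷ʳ x)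
  ∈⇒successor⊎last (a ∷ []) (here refl) = inj₂ ([] , refl)
  ∈⇒successor⊎last (a ∷ b ∷ xs) (here refl) = inj₁ (b , here refl)
  ∈⇒successor⊎last (a ∷ b ∷ xs) (there x∈) with ∈⇒successor⊎last (b ∷ xs) x∈
  ... | inj₁ (y , p∈) = inj₁ (y , there p∈)
  ... | inj₂ (ys , eq) = inj₂ (a ∷ ys , cong (a ∷_) eq)

  ∈⇒predecessor⊎head : ∀ {x : A} xs → x ∈ xs →
                       (∃ λ y → (y , x) ∈ pairs xs) ⊎ (∃ λ ys → xs ≡ x ∷ ys)
  ∈⇒predecessor⊎head (a ∷ xs) (here refl) = inj₂ (xs , refl)
  ∈⇒predecessor⊎head (a ∷ b ∷ xs) (there x∈) with ∈⇒predecessor⊎head (b ∷ xs) x∈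
  ... | inj₁ (y , p∈) = inj₁ (y , there p∈)
  ... | inj₂ (_ , refl) = inj₁ (a , here refl)

  pairs-∷ʳ-functional : ∀ {x y y' : A} xs e → Unique xs →
    (x , y) ∈ pairs (xs ∷ʳ e) → (x , y') ∈ pairs (xs ∷ʳ e) → y ≡ y'
  pairs-∷ʳ-functional (a ∷ []) e _ (here refl) (here refl) = refl
  pairs-∷ʳ-functional (a ∷ b ∷ xs) e _ (here refl) (here refl) = refl
  pairs-∷ʳ-functional (a ∷ b ∷ xs) e (a∉ ∷ _) (here refl) (there p∈) =
    ⊥-elim (All.lookup a∉ (∈-pairs-∷ʳ⁻ˡ (b ∷ xs) p∈) refl)
  pairs-∷ʳ-functional (a ∷ b ∷ xs) e (a∉ ∷ _) (there p∈) (here refl) =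
    ⊥-elim (All.lookup a∉ (∈-pairs-∷ʳ⁻ˡ (b ∷ xs) p∈) refl)
  pairs-∷ʳ-functional (a ∷ b ∷ xs) e (_ ∷ xs!) (there p∈) (there p∈′) =
    pairs-∷ʳ-functional (b ∷ xs) e xs! p∈ p∈′

  pairs-∷-injective : ∀ {x x' y : A} a xs → Unique xs →
    (x , y) ∈ pairs (a ∷ xs) → (x' , y) ∈ pairs (a ∷ xs) → x ≡ x'
  pairs-∷-injective a (b ∷ xs) _ (here refl) (here refl) = refl
  pairs-∷-injective a (b ∷ xs) (b∉ ∷ _) (here refl) (there p∈) =
    ⊥-elim (All.lookup b∉ (∈-pairs-∷⁻ʳ xs p∈) refl)
  pairs-∷-injective a (b ∷ xs) (b∉ ∷ _) (there p∈) (here refl) =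
    ⊥-elim (All.lookup b∉ (∈-pairs-∷⁻ʳ xs p∈) refl)
  pairs-∷-injective a (b ∷ xs) (_ ∷ xs!) (there p∈) (there p∈′) = pairs-∷-injective b xs xs! p∈ p∈′

  arcsOf-functional : ∀ {x y y' : A} xs → Unique xs → (x , y) ∈ arcsOf xs → (x , y') ∈ arcsOf xs → y ≡ y'
  arcsOf-functional (a ∷ xs) = pairs-∷ʳ-functional (a ∷ xs) a

  arcsOf-injective : ∀ {x x' y : A} xs → Unique xs → (x , y) ∈ arcsOf xs → (x' , y) ∈ arcsOf xs → x ≡ x'
  arcsOf-injective (a ∷ xs) xs! = pairs-∷-injective a (xs ∷ʳ a) (Unique-resp-↭ (∷↭∷ʳ a xs) xs!)

  ∈-triples⇒∈-pairs : ∀ {x y z : A} xs → (x , y , z) ∈ triples xs → (x , y) ∈ pairs xs × (y , z) ∈ pairs xs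
  ∈-triples⇒∈-pairs (a ∷ b ∷ c ∷ xs) (here refl) = here refl , there (here refl)
  ∈-triples⇒∈-pairs (a ∷ b ∷ c ∷ xs) (there t∈) =
    let xy∈ , yz∈ = ∈-triples⇒∈-pairs (b ∷ c ∷ xs) t∈ in there xy∈ , there yz∈

  cornersOf : List A → List (A × A × A)
  cornersOf xs = triples (xs ++ take 2 xs)

  ∈-cornersOf⇒∈-arcsOf : ∀ {x y z : A} xs → (x , y , z) ∈ cornersOf xs →
                         (x , y) ∈ arcsOf xs × (y , z) ∈ arcsOf xs
  ∈-cornersOf⇒∈-arcsOf (a ∷ b ∷ xs) t∈ =
    let xy∈ , yz∈ = ∈-triples⇒∈-pairs ((a ∷ b ∷ xs) ++ a ∷ b ∷ []) t∈ in wrap xy∈ , wrap yz∈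
    where
    wrap : ∀ {p} → p ∈ pairs ((a ∷ b ∷ xs) ++ a ∷ b ∷ []) → p ∈ arcsOf (a ∷ b ∷ xs)
    wrap p∈ with ∈-pairs-++⁻ (a ∷ b ∷ xs) a (b ∷ []) p∈
    ... | inj₁ p∈arcs = p∈arcs
    ... | inj₂ (here refl) = here refl

-- The elements of S are kept
-- partitioned into chains whose consecutive pairs lie in P; a pair (a , b) of P that is not yet
-- inside a chain joins the chain ending at a to the chain starting at b, and acyclicity rules out
-- that these are the same chain.
module CyclicExtension {A : Set} (S : List A) (S! : Unique S) (P : List (A × A))
  (P-functional : ∀ {a b b'} → (a , b) ∈ P → (a , b') ∈ P → b ≡ b')
  (P-injective : ∀ {a a' b} → (a , b) ∈ P → (a' , b) ∈ P → a ≡ a')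
  (P⊆S² : ∀ {a b} → (a , b) ∈ P → a ∈ S × b ∈ S)
  (P-acyclic : ∀ x xs → Unique (x ∷ xs) → ¬ (arcsOf (x ∷ xs) ⊆ P))
  where

  Linked : List (List A) → Set
  Linked chs = ∀ {ch} → ch ∈ chs → pairs ch ⊆ P

  record ChainCover : Set where
    constructor chainCover
    field
      chains : List (List A)
      chains↭S : concat chains ↭ S
      chains-linked : Linked chains
  open ChainCover

  Covers : List (List A) → A × A → Set
  Covers chs p = Any (λ ch → p ∈ pairs ch) chs

  _⊑_ : List (List A) → List (List A) → Set
  chs ⊑ chs′ = ∀ {p} → Covers chs p → Covers chs′ p

  CoverExtending : List (List A) → A × A → Set
  CoverExtending chs p = ∃ λ (C : ChainCover) → Covers (chains C) p × chs ⊑ chains C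

  pairs-join : ∀ xs a b ys → pairs (xs ∷ʳ a) ⊆ P → (a , b) ∈ P → pairs (b ∷ ys) ⊆ P →
               pairs ((xs ∷ʳ a) ++ b ∷ ys) ⊆ P
  pairs-join xs a b ys ⊆P ab b∷ys⊆P p∈ rewrite ++-assoc xs [ a ] (b ∷ ys)
    with ∈-pairs-++⁻ xs a (b ∷ ys) p∈
  ... | inj₁ p∈xs∷ʳa = ⊆P p∈xs∷ʳa
  ... | inj₂ (here refl) = ab
  ... | inj₂ (there p∈b∷ys) = b∷ys⊆P p∈b∷ys

  unchanged : ∀ {chs p} → concat chs ↭ S → Linked chs → Covers chs p → CoverExtending chs p
  unchanged ↭S linked covered = chainCover _ ↭S linked , covered , λ c → c

  join : ∀ ca′ a b t rest rest′ → rest ↭ (b ∷ t) ∷ rest′ → concat ((ca′ ∷ʳ a) ∷ rest) ↭ S →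
         Linked ((ca′ ∷ʳ a) ∷ rest) → (a , b) ∈ P → CoverExtending ((ca′ ∷ʳ a) ∷ rest) (a , b)
  join ca′ a b t rest rest′ σ ↭S linked ab =
    chainCover (joined ∷ rest′) ↭S′ linked′ , here ab∈joined , extends
    where
    joined : List A
    joined = (ca′ ∷ʳ a) ++ b ∷ t
    ∈rest : ∀ {ch} → ch ∈ (b ∷ t) ∷ rest′ → ch ∈ rest
    ∈rest = ∈-resp-↭ (↭-sym σ)
    ↭S′ : concat (joined ∷ rest′) ↭ S
    ↭S′ = ↭-trans (↭-reflexive (++-assoc (ca′ ∷ʳ a) (b ∷ t) (concat rest′)))
            (↭-trans (++⁺ˡ (ca′ ∷ʳ a) (concat-resp-↭ (↭-sym σ))) ↭S)
    linked′ : Linked (joined ∷ rest′)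
    linked′ (here refl) = pairs-join ca′ a b t (linked (here refl)) ab (linked (there (∈rest (here refl))))
    linked′ (there ch∈) = linked (there (∈rest (there ch∈)))
    ab∈joined : (a , b) ∈ pairs joined
    ab∈joined = subst (λ xs → (a , b) ∈ pairs xs) (sym (++-assoc ca′ [ a ] (b ∷ t)))
                  (∈-pairs-++⁺ʳ ca′ (here refl))
    extends : ((ca′ ∷ʳ a) ∷ rest) ⊑ (joined ∷ rest′)
    extends (here p∈) = here (∈-pairs-++⁺ˡ (ca′ ∷ʳ a) p∈)
    extends (there p∈) with Any-resp-↭ σ p∈
    ... | here p∈b∷t = here (∈-pairs-++⁺ʳ (ca′ ∷ʳ a) p∈b∷t)
    ... | there p∈rest′ = there p∈rest′

  extendFromLast : ∀ ca′ a rest → concat ((ca′ ∷ʳ a) ∷ rest) ↭ S → Linked ((ca′ ∷ʳ a) ∷ rest) →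
                   ∀ {b} → (a , b) ∈ P → CoverExtending ((ca′ ∷ʳ a) ∷ rest) (a , b)
  extendFromLast ca′ a rest ↭S linked {b} ab
    with ∈-++⁻ (ca′ ∷ʳ a) (∈-resp-↭ (↭-sym ↭S) (proj₂ (P⊆S² ab)))
  ... | inj₁ b∈ca with ∈⇒predecessor⊎head (ca′ ∷ʳ a) b∈ca
  ...   | inj₁ (y , yb∈) = unchanged ↭S linked (here (subst (λ z → (z , b) ∈ pairs (ca′ ∷ʳ a))
                             (P-injective (linked (here refl) yb∈) ab) yb∈))
  ...   | inj₂ (t , ca≡b∷t) = ⊥-elim (P-acyclic b t (subst Unique ca≡b∷t ca!) closed)
    where
    ca! : Unique (ca′ ∷ʳ a)
    ca! = Unique-++⁻ˡ (ca′ ∷ʳ a) (Unique-resp-↭ (↭-sym ↭S) S!)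
    closed : arcsOf (b ∷ t) ⊆ P
    closed = subst (λ xs → pairs (xs ∷ʳ b) ⊆ P) ca≡b∷t (pairs-join ca′ a b [] (linked (here refl)) ab (λ ()))
  extendFromLast ca′ a rest ↭S linked {b} ab | inj₂ b∈rest with ∈-concat⁻′ rest b∈rest
  ... | cb , b∈cb , cb∈rest with ∈⇒↭-∷ cb∈rest | ∈⇒predecessor⊎head cb b∈cb
  ... | rest′ , σ | inj₁ (y , yb∈) = unchanged ↭S linked (there (Any-resp-↭ (↭-sym σ) (here
          (subst (λ z → (z , b) ∈ pairs cb) (P-injective (linked (there cb∈rest) yb∈) ab) yb∈))))
  ... | rest′ , σ | inj₂ (t , refl) = join ca′ a b t rest rest′ σ ↭S linked ab

  extendAt : ∀ ca rest → concat (ca ∷ rest) ↭ S → Linked (ca ∷ rest) →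
             ∀ {a b} → a ∈ ca → (a , b) ∈ P → CoverExtending (ca ∷ rest) (a , b)
  extendAt ca rest ↭S linked {a} a∈ ab with ∈⇒successor⊎last ca a∈
  ... | inj₁ (y , ay∈) = unchanged ↭S linked (here (subst (λ z → (a , z) ∈ pairs ca)
                           (P-functional (linked (here refl) ay∈) ab) ay∈))
  ... | inj₂ (ca′ , refl) = extendFromLast ca′ a rest ↭S linked ab

  extend : ∀ (C : ChainCover) {a b} → (a , b) ∈ P → CoverExtending (chains C) (a , b)
  extend (chainCover chs ↭S linked) ab
    with ∈-concat⁻′ chs (∈-resp-↭ (↭-sym ↭S) (proj₁ (P⊆S² ab)))
  ... | ca , a∈ca , ca∈chs with ∈⇒↭-∷ ca∈chs
  ... | rest , σ with extendAt ca rest (↭-trans (concat-resp-↭ (↭-sym σ)) ↭S)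
                        (linked ∘ ∈-resp-↭ (↭-sym σ)) a∈ca ab
  ... | C , covered , extends = C , covered , extends ∘ Any-resp-↭ σ

  singletons : ChainCover
  singletons = chainCover (map [_] S) (↭-reflexive (concat-map-[ S ])) linked
    where
    linked : Linked (map [_] S)
    linked ch∈ with ∈-map⁻ [_] ch∈
    ... | _ , _ , refl = λ ()

  coverAll : ∀ Q → Q ⊆ P → ∃ λ (C : ChainCover) → ∀ {p} → p ∈ Q → Covers (chains C) p
  coverAll [] _ = singletons , λ ()
  coverAll (q ∷ Q) q∷Q⊆P with coverAll Q (q∷Q⊆P ∘ there)
  ... | C , covers with extend C (q∷Q⊆P (here refl))
  ... | C′ , q-covered , extends = C′ , λ { (here refl) → q-covered ; (there p∈Q) → extends (covers p∈Q) }

  cyclicOrder : ∃ λ L → L ↭ S × P ⊆ arcsOf L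
  cyclicOrder with coverAll P (λ p∈ → p∈)
  ... | chainCover chs ↭S _ , covers =
    concat chs , ↭S , λ p∈ → ∈-pairs-++⁺ˡ (concat chs) (∈-pairs-concat⁺ chs (covers p∈))

module _ {A : Set} where

  iter-comm : ∀ (f : A → A) k a → iter f k (f a) ≡ f (iter f k a)
  iter-comm f zero a = refl
  iter-comm f (suc k) a = cong f (iter-comm f k a)

  iter-+ : ∀ (f : A → A) k j a → iter f (k + j) a ≡ iter f k (iter f j a)
  iter-+ f zero j a = refl
  iter-+ f (suc k) j a = cong f (iter-+ f k j a)

  iter-step : ∀ (f : A → A) k {a b c} → f a ≡ b → iter f k b ≡ c → iter f (suc k) a ≡ c
  iter-step f k {a} {b} {c} fa≡b iter≡c = begin
    f (iter f k a)  ≡⟨ iter-comm f k a ⟨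
    iter f k (f a)  ≡⟨ cong (iter f k) fa≡b ⟩
    iter f k b      ≡⟨ iter≡c ⟩
    c               ∎
    where open ≡-Reasoning

  Follows : (A → A) → List A → Set
  Follows f xs = ∀ {x y} → (x , y) ∈ pairs xs → f x ≡ y

  Follows⇒reaches-last : ∀ f xs e → Follows f (xs ∷ʳ e) → ∀ {x} → x ∈ xs → ∃ λ k → iter f k x ≡ e
  Follows⇒reaches-last f (a ∷ []) e follows (here refl) = 1 , follows (here refl)
  Follows⇒reaches-last f (a ∷ b ∷ xs) e follows (here refl) =
    let k , reaches = Follows⇒reaches-last f (b ∷ xs) e (follows ∘ there) (here refl)
    in suc k , iter-step f k (follows (here refl)) reaches
  Follows⇒reaches-last f (a ∷ b ∷ xs) e follows (there x∈) =
    Follows⇒reaches-last f (b ∷ xs) e (follows ∘ there) x∈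

  Follows⇒head-reaches : ∀ f a xs → Follows f (a ∷ xs) → ∀ {x} → x ∈ a ∷ xs → ∃ λ k → iter f k a ≡ x
  Follows⇒head-reaches f a xs follows (here refl) = 0 , refl
  Follows⇒head-reaches f a (b ∷ xs) follows (there x∈) =
    let k , reaches = Follows⇒head-reaches f b xs (follows ∘ there) x∈
    in suc k , iter-step f k (follows (here refl)) reaches

module CyclicSuccessor {A : Set} (_≟_ : DecidableEquality A) where

  -- Off the list the value is junk (the argument itself); a rotation system only constrains
  -- the successor on neighbours.
  successorIn : List (A × A) → A → A
  successorIn [] u = u
  successorIn ((x , y) ∷ ps) u with x ≟ u
  ... | yes _ = y
  ... | no _ = successorIn ps u

  successorIn-∈ : ∀ {u w} ps → (u , w) ∈ ps → (u , successorIn ps u) ∈ ps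
  successorIn-∈ {u} ((x , y) ∷ ps) p∈ with x ≟ u
  ... | yes refl = here refl
  successorIn-∈ {u} ((x , y) ∷ ps) (here refl) | no x≢u = ⊥-elim (x≢u refl)
  successorIn-∈ {u} ((x , y) ∷ ps) (there p∈) | no _ = there (successorIn-∈ ps p∈)

  cyclicSucc : List A → A → A
  cyclicSucc L = successorIn (arcsOf L)

  cyclicSucc-∈-arcsOf : ∀ L {u} → u ∈ L → (u , cyclicSucc L u) ∈ arcsOf L
  cyclicSucc-∈-arcsOf (l ∷ t) u∈ = successorIn-∈ (arcsOf (l ∷ t)) (proj₂ (∈⇒∈-pairs-∷ʳ (l ∷ t) l u∈))

  cyclicSucc-arc : ∀ L → Unique L → ∀ {u w} → (u , w) ∈ arcsOf L → cyclicSucc L u ≡ w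
  cyclicSucc-arc L L! uw∈ = arcsOf-functional L L! (successorIn-∈ (arcsOf L) uw∈) uw∈

  cyclicSucc-∈ : ∀ L {u} → u ∈ L → cyclicSucc L u ∈ L
  cyclicSucc-∈ (l ∷ t) u∈ with ∈-++⁻ t (∈-pairs-∷⁻ʳ (t ∷ʳ l) (cyclicSucc-∈-arcsOf (l ∷ t) u∈))
  ... | inj₁ succ∈t = there succ∈t
  ... | inj₂ (here succ≡l) = subst (_∈ l ∷ t) (sym succ≡l) (here refl)

  cyclicSucc-injective : ∀ L → Unique L → ∀ {u w} → u ∈ L → w ∈ L →
                         cyclicSucc L u ≡ cyclicSucc L w → u ≡ w
  cyclicSucc-injective L L! u∈ w∈ eq = arcsOf-injective L L! (cyclicSucc-∈-arcsOf L u∈)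
    (subst (λ z → (_ , z) ∈ arcsOf L) (sym eq) (cyclicSucc-∈-arcsOf L w∈))

  cyclicSucc-orbit : ∀ L → Unique L → ∀ {u w} → u ∈ L → w ∈ L → ∃ λ k → iter (cyclicSucc L) k u ≡ w
  cyclicSucc-orbit (l ∷ t) L! {u} {w} u∈ w∈ =
    let k₁ , u↝l = Follows⇒reaches-last f (l ∷ t) l follows u∈
        k₂ , l↝w = Follows⇒head-reaches f l t (follows ∘ ∈-pairs-++⁺ˡ (l ∷ t)) w∈
    in k₂ + k₁ , (begin
      iter f (k₂ + k₁) u      ≡⟨ iter-+ f k₂ k₁ u ⟩
      iter f k₂ (iter f k₁ u) ≡⟨ cong (iter f k₂) u↝l ⟩
      iter f k₂ l             ≡⟨ l↝w ⟩
      w                       ∎)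
    where
    open ≡-Reasoning
    f = cyclicSucc (l ∷ t)
    follows : Follows f ((l ∷ t) ∷ʳ l)
    follows = cyclicSucc-arc (l ∷ t) L!

module _ {A : Set} where

  lookup-∈-pairs : ∀ (xs : List A) i j → suc (Fin.toℕ i) ≡ Fin.toℕ j → (lookup xs i , lookup xs j) ∈ pairs xs
  lookup-∈-pairs (a ∷ b ∷ xs) Fin.zero (Fin.suc Fin.zero) _ = here refl
  lookup-∈-pairs (a ∷ b ∷ xs) (Fin.suc i) (Fin.suc j) eq = there (lookup-∈-pairs (b ∷ xs) i j (suc-injective eq))

  lookup-last-∈-pairs-∷ʳ : ∀ (xs : List A) e i → suc (Fin.toℕ i) ≡ length xs →
                           (lookup xs i , e) ∈ pairs (xs ∷ʳ e)
  lookup-last-∈-pairs-∷ʳ (a ∷ []) e Fin.zero _ = here refl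
  lookup-last-∈-pairs-∷ʳ (a ∷ b ∷ xs) e (Fin.suc i) eq =
    there (lookup-last-∈-pairs-∷ʳ (b ∷ xs) e i (suc-injective eq))

  lookup-csuc-∈-arcsOf : ∀ (x : A) xs i → (lookup (x ∷ xs) i , lookup (x ∷ xs) (csuc i)) ∈ arcsOf (x ∷ xs)
  lookup-csuc-∈-arcsOf x xs i with suc (Fin.toℕ i) ≟ℕ suc (length xs)
  ... | yes i-last = subst (λ j → (lookup (x ∷ xs) i , lookup (x ∷ xs) j) ∈ arcsOf (x ∷ xs)) (sym csuc-i≡0)
                       (lookup-last-∈-pairs-∷ʳ (x ∷ xs) x i i-last)
    where
    csuc-i≡0 : csuc i ≡ Fin.zero
    csuc-i≡0 = toℕ-injective (begin
      Fin.toℕ (csuc i)                     ≡⟨ toℕ-fromℕ< _ ⟩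
      suc (Fin.toℕ i) % suc (length xs)    ≡⟨ cong (_% suc (length xs)) i-last ⟩
      suc (length xs) % suc (length xs)    ≡⟨ n%n≡0 (suc (length xs)) ⟩
      0                                    ∎)
      where open ≡-Reasoning
  ... | no i-not-last = ∈-pairs-++⁺ˡ (x ∷ xs) (lookup-∈-pairs (x ∷ xs) i (csuc i) (sym (begin
      Fin.toℕ (csuc i)                     ≡⟨ toℕ-fromℕ< _ ⟩
      suc (Fin.toℕ i) % suc (length xs)    ≡⟨ m<n⇒m%n≡m (≤∧≢⇒< (toℕ<n i) i-not-last) ⟩
      suc (Fin.toℕ i)                      ∎)))
    where open ≡-Reasoning

module Transitions {A : Set} (_≟_ : DecidableEquality A) where

  middle : A × A × A → A
  middle (_ , y , _) = y

  ends : A × A × A → A × A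
  ends (x , _ , z) = x , z

  transitionsOf : A → List A → List (A × A)
  transitionsOf v c = map ends (filter (λ t → middle t ≟ v) (cornersOf c))

  transitionsAt : A → List (List A) → List (A × A)
  transitionsAt v = concatMap (transitionsOf v)

  ∈-transitionsAt⁺ : ∀ {v x z c} {F : List (List A)} → c ∈ F → (x , v , z) ∈ cornersOf c →
                     (x , z) ∈ transitionsAt v F
  ∈-transitionsAt⁺ {v} c∈ t∈ =
    ∈-concatMap⁺ (transitionsOf v) (lose c∈ (∈-map⁺ ends (∈-filter⁺ (λ t → middle t ≟ v) t∈ refl)))

  ∈-transitionsAt⁻ : ∀ {v x z} (F : List (List A)) → (x , z) ∈ transitionsAt v F →
                     ∃ λ i → (x , v) ∈ arcsOf (lookup F i) × (v , z) ∈ arcsOf (lookup F i)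
  ∈-transitionsAt⁻ {v} F p∈ with ∈-concatMap⁻ (transitionsOf v) {xs = F} p∈
  ... | p∈some with ∈-map⁻ ends (lookup-index p∈some)
  ... | (x , y , z) , t∈ , refl with ∈-filter⁻ (λ t → middle t ≟ v) {xs = cornersOf (lookup F (index p∈some))} t∈
  ... | t∈corners , refl = index p∈some , ∈-cornersOf⇒∈-arcsOf (lookup F (index p∈some)) t∈corners

module FacialRotationSystem {n : ℕ} {G : Fin n → Fin n → Bool}
  (G-sym : ∀ u v → Adj G u v → Adj G v u)
  (F : List (List (Fin n))) (F-cycles : All (DirCycle G) F)
  (F-arcDisjoint : ArcDisjoint F) (F-blossomFree : BlossomFree F) where

  open Transitions (Fin._≟_ {n})
  open CyclicSuccessor (Fin._≟_ {n})

  neighbours : Fin n → List (Fin n)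
  neighbours v = filter (λ u → G v u Bool.≟ true) (allFin n)

  neighbours! : ∀ v → Unique (neighbours v)
  neighbours! v = Unique.filter⁺ (λ u → G v u Bool.≟ true) (Unique.allFin⁺ n)

  ∈-neighbours⁺ : ∀ {v u} → Adj G v u → u ∈ neighbours v
  ∈-neighbours⁺ {v} {u} vu = ∈-filter⁺ (λ u → G v u Bool.≟ true) (∈-allFin u) vu

  ∈-neighbours⁻ : ∀ {v u} → u ∈ neighbours v → Adj G v u
  ∈-neighbours⁻ {v} u∈ = proj₂ (∈-filter⁻ (λ u → G v u Bool.≟ true) {xs = allFin n} u∈)

  cycle! : ∀ i → Unique (lookup F i)
  cycle! i = proj₁ (proj₂ (All.lookup F-cycles (∈-lookup {xs = F} i)))

  cycle-arc : ∀ i {x y} → (x , y) ∈ arcsOf (lookup F i) → Adj G x y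
  cycle-arc i = All.lookup (proj₂ (proj₂ (All.lookup F-cycles (∈-lookup {xs = F} i))))

  shared-arc⇒same-cycle : ∀ {e} i j → e ∈ arcsOf (lookup F i) → e ∈ arcsOf (lookup F j) → i ≡ j
  shared-arc⇒same-cycle i j = Unique-concatMap⇒same-index arcsOf F F-arcDisjoint {i = i} {j}

  transitions-functional : ∀ v {a b b'} → (a , b) ∈ transitionsAt v F → (a , b') ∈ transitionsAt v F →
                           b ≡ b'
  transitions-functional v {b' = b'} ab∈ ab'∈ =
    let i , av∈ , vb∈ = ∈-transitionsAt⁻ F ab∈
        j , av∈′ , vb'∈ = ∈-transitionsAt⁻ F ab'∈
    in arcsOf-functional (lookup F i) (cycle! i) vb∈
         (subst (λ k → (v , b') ∈ arcsOf (lookup F k)) (shared-arc⇒same-cycle j i av∈′ av∈) vb'∈)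

  transitions-injective : ∀ v {a a' b} → (a , b) ∈ transitionsAt v F → (a' , b) ∈ transitionsAt v F →
                          a ≡ a'
  transitions-injective v {a' = a'} ab∈ a'b∈ =
    let i , av∈ , vb∈ = ∈-transitionsAt⁻ F ab∈
        j , a'v∈ , vb∈′ = ∈-transitionsAt⁻ F a'b∈
    in arcsOf-injective (lookup F i) (cycle! i) av∈
         (subst (λ k → (a' , v) ∈ arcsOf (lookup F k)) (shared-arc⇒same-cycle j i vb∈′ vb∈) a'v∈)

  transitions⊆neighbours : ∀ v {a b} → (a , b) ∈ transitionsAt v F → a ∈ neighbours v × b ∈ neighbours v
  transitions⊆neighbours v ab∈ =
    let i , av∈ , vb∈ = ∈-transitionsAt⁻ F ab∈
    in ∈-neighbours⁺ (G-sym _ _ (cycle-arc i av∈)) , ∈-neighbours⁺ (cycle-arc i vb∈)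

  -- A cycle x₀ … x_m of transitions at v is a blossom centred at v with tips x_i, the petal at x_i
  -- being the walk that carries the transition (x_i , x_{i+1}); the petals are distinct because a
  -- walk through v has only one arc entering v.
  transitions-acyclic : ∀ v x xs → Unique (x ∷ xs) → ¬ (arcsOf (x ∷ xs) ⊆ transitionsAt v F)
  transitions-acyclic v x xs xs! ⊆T = F-blossomFree v (length xs) petal tip (petal-injective , petal-arcs)
    where
    tip : Fin (suc (length xs)) → Fin n
    tip = lookup (x ∷ xs)
    petal-of : ∀ i → ∃ λ j → (tip i , v) ∈ arcsOf (lookup F j) × (v , tip (csuc i)) ∈ arcsOf (lookup F j)
    petal-of i = ∈-transitionsAt⁻ F (⊆T (lookup-csuc-∈-arcsOf x xs i))
    petal : Fin (suc (length xs)) → Fin (length F)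
    petal i = proj₁ (petal-of i)
    petal-arcs : ∀ i → (tip i , v) ∈ arcsOf (lookup F (petal i)) ×
                       (v , tip (csuc i)) ∈ arcsOf (lookup F (petal i))
    petal-arcs i = proj₂ (petal-of i)
    petal-injective : ∀ {i j} → petal i ≡ petal j → i ≡ j
    petal-injective {i} {j} eq = Unique⇒lookup-injective (x ∷ xs) xs!
      (arcsOf-injective (lookup F (petal i)) (cycle! (petal i)) (proj₁ (petal-arcs i))
        (subst (λ k → (tip j , v) ∈ arcsOf (lookup F k)) (sym eq) (proj₁ (petal-arcs j))))

  rotationOrder : ∀ v → ∃ λ L → L ↭ neighbours v × transitionsAt v F ⊆ arcsOf L
  rotationOrder v = CyclicExtension.cyclicOrder (neighbours v) (neighbours! v) (transitionsAt v F)
    (transitions-functional v) (transitions-injective v) (transitions⊆neighbours v) (transitions-acyclic v)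

  order : Fin n → List (Fin n)
  order v = proj₁ (rotationOrder v)

  order↭neighbours : ∀ v → order v ↭ neighbours v
  order↭neighbours v = proj₁ (proj₂ (rotationOrder v))

  transitions⊆order : ∀ v → transitionsAt v F ⊆ arcsOf (order v)
  transitions⊆order v = proj₂ (proj₂ (rotationOrder v))

  order! : ∀ v → Unique (order v)
  order! v = Unique-resp-↭ (↭-sym (order↭neighbours v)) (neighbours! v)

  ∈-order⁺ : ∀ {v u} → Adj G v u → u ∈ order v
  ∈-order⁺ {v} = ∈-resp-↭ (↭-sym (order↭neighbours v)) ∘ ∈-neighbours⁺

  ∈-order⁻ : ∀ {v u} → u ∈ order v → Adj G v u
  ∈-order⁻ {v} = ∈-neighbours⁻ ∘ ∈-resp-↭ (order↭neighbours v)

  ρ : Fin n → Fin n → Fin n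
  ρ v = cyclicSucc (order v)

  ρ-isRotationSystem : IsRotationSystem G ρ
  ρ-isRotationSystem v =
    (λ u vu → ∈-order⁻ (cyclicSucc-∈ (order v) (∈-order⁺ vu))) ,
    (λ u w vu vw → cyclicSucc-injective (order v) (order! v) (∈-order⁺ vu) (∈-order⁺ vw)) ,
    (λ u w vu vw → cyclicSucc-orbit (order v) (order! v) (∈-order⁺ vu) (∈-order⁺ vw))

  ρ-facial : All (Facial ρ) F
  ρ-facial = All.tabulate λ c∈ → All.tabulate λ { {x , y , z} t∈ →
    cyclicSucc-arc (order y) (order! y) (transitions⊆order y (∈-transitionsAt⁺ c∈ t∈)) }

module _ {n : ℕ} where

  DirCycle-mono : ∀ {R R′ : Fin n → Fin n → Bool} → (∀ {u v} → Adj R u v → Adj R′ u v) →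
                  ∀ {c} → DirCycle R c → DirCycle R′ c
  DirCycle-mono R⊆R′ (nonempty , c! , arcs) = nonempty , c! , All.map R⊆R′ arcs

  ∈-arcs⇒Adj : ∀ {R : Fin n → Fin n → Bool} {C} → All (DirCycle R) C →
               ∀ {e} → e ∈ concatMap arcsOf C → Adj R (proj₁ e) (proj₂ e)
  ∈-arcs⇒Adj cycles e∈ = All.lookupWith (λ cycle e∈c → All.lookup (proj₂ (proj₂ cycle)) e∈c) cycles
                           (∈-concatMap⁻ arcsOf e∈)

  ArcDisjoint-++ : ∀ {G D : Fin n → Fin n → Bool} → IsOrientation G D → ∀ {C₁ C₂} →
                   All (DirCycle D) C₁ → ArcDisjoint C₁ → All (DirCycle (inv D)) C₂ → ArcDisjoint C₂ →
                   ArcDisjoint (C₁ ++ C₂)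
  ArcDisjoint-++ (D⊆G , one-arc) {C₁} {C₂} C₁-cycles C₁-disjoint C₂-cycles C₂-disjoint =
    subst Unique (sym (concatMap-++ arcsOf C₁ C₂)) (Unique.++⁺ C₁-disjoint C₂-disjoint no-shared-arc)
    where
    no-shared-arc : Disjoint (concatMap arcsOf C₁) (concatMap arcsOf C₂)
    no-shared-arc (e∈₁ , e∈₂) =
      let uv∈D = ∈-arcs⇒Adj C₁-cycles e∈₁
      in proj₂ (one-arc _ _ (D⊆G _ _ uv∈D)) (uv∈D , ∈-arcs⇒Adj C₂-cycles e∈₂)

lemma2p2 : (n : ℕ) (G D : Fin n → Fin n → Bool) →
    SimpleGraph G → IsOrientation G D →
    (C₁ C₂ : List (List (Fin n))) →
    All (DirCycle D) C₁ → ArcDisjoint C₁ →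
    All (DirCycle (inv D)) C₂ → ArcDisjoint C₂ →
    BlossomFree (C₁ ++ C₂) →
    ∃[ ρ ] (IsRotationSystem G ρ × All (Facial ρ) (C₁ ++ C₂))
lemma2p2 n G D (G-sym , _) orientation@(D⊆G , _) C₁ C₂
         C₁-cycles C₁-disjoint C₂-cycles C₂-disjoint blossomFree =
  ρ , ρ-isRotationSystem , ρ-facial
  where
  cycles : All (DirCycle G) (C₁ ++ C₂)
  cycles = All.++⁺ (All.map (DirCycle-mono (D⊆G _ _)) C₁-cycles)
                   (All.map (DirCycle-mono (G-sym _ _ ∘ D⊆G _ _)) C₂-cycles)
  open FacialRotationSystem G-sym (C₁ ++ C₂) cycles
         (ArcDisjoint-++ orientation C₁-cycles C₁-disjoint C₂-cycles C₂-disjoint) blossomFree
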